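{- Let $\Pi_3$ be the path on vertex set $\{1,2,3,4\}$ with edges $\{1,2\},\{2,3\},\{3,4\}$, and let $$C(\Pi_3)=\operatorname{conv}\Big\{\sum_{i\in J}\pm e_i \;\Big|\; J\subseteq\{1,2,3,4\}\text{ induces a complete subgraph of }\Pi_3\Big\}\subset\mathbb{R}^4.$$ Then $C(\Pi_3)$ does not have exactly $3^4$ non-empty faces.
   Context: The sum ranges over all choices of signs; $J=\emptyset$, singletons, and the three edges are the subsets inducing complete subgraphs. (In the paper, a proper locally anti-blocking polytope in $\mathbb{R}^d$ with exactly $3^d$ non-empty faces is called a minimizer; the claim is that $C(\Pi_3)$ is not a minimizer.)
   Formalization: The polytope $C(\Pi_3)$ and its faces are taken over ℚ^4 instead of ℝ^4, with rational coefficients in the convex combinations and rational linear functionals exposing the faces. -}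

module Defs where

open import Data.Nat using (ℕ; zero; suc)
open import Data.Fin using (Fin; toℕ; zero; suc)
open import Data.Empty using (⊥)
open import Data.Bool using (Bool; true; false; if_then_else_)
open import Data.Rational using (ℚ; 0ℚ; 1ℚ; -_; _+_; _*_; _≤_)
open import Data.Product using (Σ; ∃; _×_)
open import Data.Sum using (_⊎_)
open import Relation.Binary.PropositionalEquality using (_≡_; _≢_)

Pt : ℕ → Set
Pt d = Fin d → ℚ

sumFin : (n : ℕ) → (Fin n → ℚ) → ℚ
sumFin zero    f = 0ℚ
sumFin (suc n) f = f zero + sumFin n (λ i → f (suc i))

dot : ∀ {d} → Pt d → Pt d → ℚ
dot {d} c x = sumFin d (λ i → c i * x i)

-- The path Π₃ on vertices {1,2,3,4}, encoded as Fin 4 = {0,1,2,3};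
-- edges {i, i+1}.
AdjΠ₃ : Fin 4 → Fin 4 → Set
AdjΠ₃ i j = (toℕ j ≡ suc (toℕ i)) ⊎ (toℕ i ≡ suc (toℕ j))

IsClique : (Fin 4 → Bool) → Set
IsClique J = ∀ i j → i ≢ j → J i ≡ true → J j ≡ true → AdjΠ₃ i j

signedSum : (Fin 4 → Bool) → (Fin 4 → Bool) → Pt 4
signedSum J s i = if J i then (if s i then 1ℚ else - 1ℚ) else 0ℚ

Gen : Pt 4 → Set
Gen x = Σ (Fin 4 → Bool) λ J → IsClique J × Σ (Fin 4 → Bool) λ s → x ≡ signedSum J s

InConv : ∀ {d} → (Pt d → Set) → Pt d → Set
InConv {d} S x =
  Σ ℕ λ n → Σ (Fin n → ℚ) λ λs → Σ (Fin n → Pt d) λ p →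
    (∀ k → 0ℚ ≤ λs k) × (sumFin n λs ≡ 1ℚ) × (∀ k → S (p k)) ×
    (∀ i → x i ≡ sumFin n (λ k → λs k * p k i))

CΠ₃ : Pt 4 → Set
CΠ₃ = InConv Gen

-- The (non-empty) face of C(Π₃) exposed by the linear functional c:
-- the points of C(Π₃) maximizing ⟨c,·⟩ over C(Π₃).  (c = 0 gives C(Π₃).)
Face : Pt 4 → Pt 4 → Set
Face c x = CΠ₃ x × (∀ y → CΠ₃ y → dot c y ≤ dot c x)

SameFace : Pt 4 → Pt 4 → Set
SameFace c c' = ∀ x → (Face c x → Face c' x) × (Face c' x → Face c x)

HasExactlyFaces : ℕ → Set
HasExactlyFaces m =
  Σ (Fin m → Pt 4) λ c →
    (∀ k l → k ≢ l → SameFace (c k) (c l) → ⊥) ×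
    (∀ d → ∃ λ k → SameFace d (c k))

module Submission where

-- The support function of C(Π₃) is h(c) = max over the edges {i, i+1} of |cᵢ| + |cᵢ₊₁|:
-- a generator Σ_{i∈J} ±eᵢ has ⟨c, x⟩ ≤ Σ_{i∈J} |cᵢ|, every clique J lies in an edge, and
-- h(c) is attained at the edge vertex with signs sgn(cᵢ). Hence the face exposed by c
-- contains exactly those of the 12 vertices ±eᵢ ± eᵢ₊₁ on which ⟨c, ·⟩ equals h(c), and
-- this is computable. C(Π₃) has f-vector (12, 36, 36, 12), so 97 non-empty faces; explicit
-- integer functionals exposing them have pairwise different vertex sets, and by pigeonhole
-- 81 faces cannot account for all of them.

open import Defs
open import Relation.Nullary using (¬_)

open import Algebra.Bundles using (CommutativeRing)
import Algebra.Properties.CommutativeSemigroup as CommutativeSemigroupProperties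
import Algebra.Properties.Semiring.Sum as SemiringSum
open import Data.Bool using (Bool; true; false; if_then_else_; _∨_)
open import Data.Bool.Properties using () renaming (_≟_ to _≟ᵇ_)
open import Data.Empty using (⊥; ⊥-elim)
open import Data.Fin using (Fin; zero; suc; toℕ; _<_)
open import Data.Fin.Patterns using (0F; 1F; 2F; 3F)
open import Data.Fin.Properties using (pigeonhole; all?) renaming (_≟_ to _≟ᶠ_)
import Data.Integer as ℤ
open import Data.List using (List; []; _∷_; map; foldr; cartesianProduct; allFin; lookup)
open import Data.List.Membership.Propositional.Properties using (∈-lookup)
open import Data.List.Properties using (map-cong)
import Data.List.Relation.Unary.All as All
open import Data.List.Relation.Unary.AllPairs using (AllPairs; _∷_)
open import Data.List.Relation.Unary.Linked using (linked?)
open import Data.List.Relation.Unary.Linked.Properties as Linked using (Linked⇒AllPairs)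
open import Data.Nat as ℕ using (ℕ; zero; suc; _≡ᵇ_; s<s)
import Data.Nat.Properties as ℕₚ
open import Data.Product using (∃; ∃₂; _×_; _,_; proj₁; proj₂)
open import Data.Rational using (ℚ; mkℚ; nonNegative; 0ℚ; 1ℚ; -_; _+_; _*_; _≤_; ∣_∣; _⊔_)
open import Data.Rational.Properties
  using ( _≟_; _≤?_; ≤-refl; ≤-reflexive; ≤-trans; ≤-antisym; module ≤-Reasoning
        ; +-*-commutativeRing; +-mono-≤; *-monoˡ-≤-nonNeg; +-identityʳ; *-identityˡ; *-identityʳ
        ; *-zeroʳ; neg-distribʳ-*; nonNegative⁻¹; nonPositive⁻¹
        ; 0≤∣p∣; ∣-p∣≡∣p∣; 0≤p⇒∣p∣≡p; ∣p∣≡p⇒0≤p; ∣p∣≡p∨∣p∣≡-p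
        ; ⊔-sel; p≤p⊔q; p≤q⊔p; p≤q⇒p≤q⊔r )
open import Data.Sum using (inj₁; inj₂)
open import Function using (_∘_; _⇔_; mk⇔)
import Function.Properties.Equivalence as ⇔
open import Relation.Binary.PropositionalEquality
open import Relation.Nullary using (yes; no; contradiction)
open import Relation.Nullary.Decidable
  using (Dec; False; does; does-⇔; from-yes; toWitnessFalse; ¬?; _⊎-dec_; _→-dec_)

open SemiringSum (CommutativeRing.semiring +-*-commutativeRing)
  using (sum-syntax; sum-cong-≗; ∑-comm; *-distribˡ-sum; *-distribʳ-sum)
open CommutativeSemigroupProperties (CommutativeRing.*-commutativeSemigroup +-*-commutativeRing)
  using (x∙yz≈y∙xz)

sumFin≡sum : ∀ n (f : Fin n → ℚ) → sumFin n f ≡ ∑[ i < n ] f i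
sumFin≡sum zero    f = refl
sumFin≡sum (suc n) f = cong (f zero +_) (sumFin≡sum n (f ∘ suc))

sumFin-cong : ∀ n {f g : Fin n → ℚ} → (∀ i → f i ≡ g i) → sumFin n f ≡ sumFin n g
sumFin-cong zero    f≗g = refl
sumFin-cong (suc n) f≗g = cong₂ _+_ (f≗g zero) (sumFin-cong n (f≗g ∘ suc))

sumFin-mono-≤ : ∀ n {f g : Fin n → ℚ} → (∀ i → f i ≤ g i) → sumFin n f ≤ sumFin n g
sumFin-mono-≤ zero    f≤g = ≤-refl
sumFin-mono-≤ (suc n) f≤g = +-mono-≤ (f≤g zero) (sumFin-mono-≤ n (f≤g ∘ suc))

dot-sumFin : ∀ {d n} (c : Pt d) (w : Fin n → ℚ) (p : Fin n → Pt d) →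
             dot c (λ i → sumFin n (λ k → w k * p k i)) ≡ sumFin n (λ k → w k * dot c (p k))
dot-sumFin {d} {n} c w p = begin
  sumFin d (λ i → c i * sumFin n (λ k → w k * p k i)) ≡⟨ sumFin≡sum d _ ⟩
  ∑[ i < d ] (c i * sumFin n (λ k → w k * p k i))     ≡⟨ sum-cong-≗ (λ i → cong (c i *_) (sumFin≡sum n _)) ⟩
  ∑[ i < d ] (c i * ∑[ k < n ] (w k * p k i))         ≡⟨ sum-cong-≗ (λ i → *-distribˡ-sum (c i) (λ k → w k * p k i)) ⟩
  ∑[ i < d ] ∑[ k < n ] (c i * (w k * p k i))         ≡⟨ ∑-comm (λ i k → c i * (w k * p k i)) ⟩
  ∑[ k < n ] ∑[ i < d ] (c i * (w k * p k i))         ≡⟨ sum-cong-≗ (λ k → sum-cong-≗ (λ i → x∙yz≈y∙xz (c i) (w k) (p k i))) ⟩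
  ∑[ k < n ] ∑[ i < d ] (w k * (c i * p k i))         ≡⟨ sum-cong-≗ (λ k → *-distribˡ-sum (w k) (λ i → c i * p k i)) ⟨
  ∑[ k < n ] (w k * ∑[ i < d ] (c i * p k i))         ≡⟨ sum-cong-≗ (λ k → cong (w k *_) (sumFin≡sum d _)) ⟨
  ∑[ k < n ] (w k * dot c (p k))                      ≡⟨ sumFin≡sum n _ ⟨
  sumFin n (λ k → w k * dot c (p k))                  ∎
  where open ≡-Reasoning

InConv-singleton : ∀ {d} {S : Pt d → Set} {x} → S x → InConv S x
InConv-singleton {x = x} x∈S =
  1 , (λ _ → 1ℚ) , (λ _ → x) , (λ _ → nonNegative⁻¹ 1ℚ) , +-identityʳ 1ℚ , (λ _ → x∈S) ,
  (λ i → sym (trans (+-identityʳ _) (*-identityˡ (x i))))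

InConv-dot≤ : ∀ {d} {S : Pt d → Set} (c : Pt d) (M : ℚ) →
              (∀ x → S x → dot c x ≤ M) → ∀ {x} → InConv S x → dot c x ≤ M
InConv-dot≤ {d} c M S≤M {x} (n , w , p , w≥0 , Σw≡1 , p∈S , x≡Σwp) = begin
  dot c x                                    ≡⟨ sumFin-cong d (λ i → cong (c i *_) (x≡Σwp i)) ⟩
  dot c (λ i → sumFin n (λ k → w k * p k i)) ≡⟨ dot-sumFin c w p ⟩
  sumFin n (λ k → w k * dot c (p k))         ≤⟨ sumFin-mono-≤ n (λ k → *-monoˡ-≤-nonNeg (w k) {{nonNegative (w≥0 k)}} (S≤M (p k) (p∈S k))) ⟩
  sumFin n (λ k → w k * M)                   ≡⟨ sumFin≡sum n _ ⟩
  ∑[ k < n ] (w k * M)                       ≡⟨ *-distribʳ-sum M w ⟨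
  (∑[ k < n ] w k) * M                       ≡⟨ cong (_* M) (trans (sym (sumFin≡sum n w)) Σw≡1) ⟩
  1ℚ * M                                     ≡⟨ *-identityˡ M ⟩
  M                                          ∎
  where open ≤-Reasoning

sign : Bool → ℚ
sign s = if s then 1ℚ else - 1ℚ

p≤∣p∣ : ∀ p → p ≤ ∣ p ∣
p≤∣p∣ p@(mkℚ (ℤ.+ _)    _ _) = ≤-refl
p≤∣p∣ p@(mkℚ ℤ.-[1+ _ ] _ _) = ≤-trans (nonPositive⁻¹ p) (0≤∣p∣ p)

p*-1≡-p : ∀ p → p * - 1ℚ ≡ - p
p*-1≡-p p = trans (sym (neg-distribʳ-* p 1ℚ)) (cong -_ (*-identityʳ p))

p*sign≤∣p∣ : ∀ p s → p * sign s ≤ ∣ p ∣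
p*sign≤∣p∣ p true  = ≤-trans (≤-reflexive (*-identityʳ p)) (p≤∣p∣ p)
p*sign≤∣p∣ p false = begin
  p * - 1ℚ ≡⟨ p*-1≡-p p ⟩
  - p      ≤⟨ p≤∣p∣ (- p) ⟩
  ∣ - p ∣  ≡⟨ ∣-p∣≡∣p∣ p ⟩
  ∣ p ∣    ∎
  where open ≤-Reasoning

p*sign≡∣p∣ : ∀ p (0≤p? : Dec (0ℚ ≤ p)) → p * sign (does 0≤p?) ≡ ∣ p ∣
p*sign≡∣p∣ p (yes 0≤p) = trans (*-identityʳ p) (sym (0≤p⇒∣p∣≡p 0≤p))
p*sign≡∣p∣ p (no 0≰p) with ∣p∣≡p∨∣p∣≡-p p
... | inj₁ ∣p∣≡p  = contradiction (∣p∣≡p⇒0≤p ∣p∣≡p) 0≰p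
... | inj₂ ∣p∣≡-p = trans (p*-1≡-p p) (sym ∣p∣≡-p)

weight : ∀ {d} → (Fin d → Bool) → Pt d → ℚ
weight {d} J c = sumFin d (λ i → if J i then ∣ c i ∣ else 0ℚ)

_⊆_ : ∀ {d} → (Fin d → Bool) → (Fin d → Bool) → Set
J ⊆ K = ∀ i → J i ≡ true → K i ≡ true

weight-mono-⊆ : ∀ {d} {J K : Fin d → Bool} (c : Pt d) → J ⊆ K → weight J c ≤ weight K c
weight-mono-⊆ {d} {J} {K} c J⊆K = sumFin-mono-≤ d term
  where
  term : ∀ i → (if J i then ∣ c i ∣ else 0ℚ) ≤ (if K i then ∣ c i ∣ else 0ℚ)
  term i with J i in Jᵢ | K i in Kᵢ
  ... | false | false = ≤-refl
  ... | false | true  = 0≤∣p∣ (c i)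
  ... | true  | true  = ≤-refl
  ... | true  | false = contradiction (trans (sym Kᵢ) (J⊆K i Jᵢ)) λ ()

dot-signedSum≤weight : ∀ (c : Pt 4) J s → dot c (signedSum J s) ≤ weight J c
dot-signedSum≤weight c J s = sumFin-mono-≤ 4 (λ i → term (J i) (c i) (s i))
  where
  term : ∀ b p s → p * (if b then sign s else 0ℚ) ≤ (if b then ∣ p ∣ else 0ℚ)
  term true  p s = p*sign≤∣p∣ p s
  term false p s = ≤-reflexive (*-zeroʳ p)

signs : Pt 4 → Fin 4 → Bool
signs c i = does (0ℚ ≤? c i)

dot-signedSum-signs≡weight : ∀ (c : Pt 4) J → dot c (signedSum J (signs c)) ≡ weight J c
dot-signedSum-signs≡weight c J = sumFin-cong 4 (λ i → term (J i) (c i))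
  where
  term : ∀ b p → p * (if b then sign (does (0ℚ ≤? p)) else 0ℚ) ≡ (if b then ∣ p ∣ else 0ℚ)
  term true  p = p*sign≡∣p∣ p (0ℚ ≤? p)
  term false p = *-zeroʳ p

edge : Fin 3 → Fin 4 → Bool
edge k i = (toℕ i ≡ᵇ toℕ k) ∨ (toℕ i ≡ᵇ suc (toℕ k))

adjacent? : ∀ i j → Dec (AdjΠ₃ i j)
adjacent? i j = (toℕ j ℕ.≟ suc (toℕ i)) ⊎-dec (toℕ i ℕ.≟ suc (toℕ j))

nonadjacent : ∀ i j {_ : False (adjacent? i j)} → ¬ AdjΠ₃ i j
nonadjacent i j {i≁j} = toWitnessFalse i≁j

isClique? : ∀ J → Dec (IsClique J)
isClique? J = all? λ i → all? λ j →
  ¬? (i ≟ᶠ j) →-dec (J i ≟ᵇ true →-dec (J j ≟ᵇ true →-dec adjacent? i j))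

edge-isClique : ∀ k → IsClique (edge k)
edge-isClique = from-yes (all? (isClique? ∘ edge))

clique⊆edge : ∀ {J} → IsClique J → ∃ λ k → J ⊆ edge k
clique⊆edge {J} J-clique with J 0F in J₀ | J 3F in J₃
... | true  | _    = 0F , λ where
  0F _   → refl
  1F _   → refl
  2F J₂  → ⊥-elim (nonadjacent 0F 2F (J-clique 0F 2F (λ ()) J₀ J₂))
  3F J₃′ → ⊥-elim (nonadjacent 0F 3F (J-clique 0F 3F (λ ()) J₀ J₃′))
... | false | true  = 2F , λ where
  0F J₀′ → contradiction (trans (sym J₀) J₀′) λ ()
  1F J₁  → ⊥-elim (nonadjacent 1F 3F (J-clique 1F 3F (λ ()) J₁ J₃))
  2F _   → refl
  3F _   → refl
... | false | false = 1F , λ where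
  0F J₀′ → contradiction (trans (sym J₀) J₀′) λ ()
  1F _   → refl
  2F _   → refl
  3F J₃′ → contradiction (trans (sym J₃) J₃′) λ ()

support : Pt 4 → ℚ
support c = weight (edge 0F) c ⊔ weight (edge 1F) c ⊔ weight (edge 2F) c

weight-edge≤support : ∀ c k → weight (edge k) c ≤ support c
weight-edge≤support c 0F = p≤q⇒p≤q⊔r (weight (edge 2F) c) (p≤p⊔q (weight (edge 0F) c) (weight (edge 1F) c))
weight-edge≤support c 1F = p≤q⇒p≤q⊔r (weight (edge 2F) c) (p≤q⊔p (weight (edge 0F) c) (weight (edge 1F) c))
weight-edge≤support c 2F = p≤q⊔p (weight (edge 0F) c ⊔ weight (edge 1F) c) (weight (edge 2F) c)

support-attained : ∀ c → ∃ λ k → weight (edge k) c ≡ support c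
support-attained c with ⊔-sel (weight (edge 0F) c ⊔ weight (edge 1F) c) (weight (edge 2F) c)
... | inj₂ ⊔≡w₂ = 2F , sym ⊔≡w₂
... | inj₁ ⊔≡w₀₁ with ⊔-sel (weight (edge 0F) c) (weight (edge 1F) c)
...   | inj₁ w₀₁≡w₀ = 0F , sym (trans ⊔≡w₀₁ w₀₁≡w₀)
...   | inj₂ w₀₁≡w₁ = 1F , sym (trans ⊔≡w₀₁ w₀₁≡w₁)

Gen-dot≤support : ∀ c {x} → Gen x → dot c x ≤ support c
Gen-dot≤support c (J , J-clique , s , refl) with k , J⊆edge ← clique⊆edge J-clique = begin
  dot c (signedSum J s) ≤⟨ dot-signedSum≤weight c J s ⟩
  weight J c            ≤⟨ weight-mono-⊆ c J⊆edge ⟩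
  weight (edge k) c     ≤⟨ weight-edge≤support c k ⟩
  support c             ∎
  where open ≤-Reasoning

CΠ₃-dot≤support : ∀ c {x} → CΠ₃ x → dot c x ≤ support c
CΠ₃-dot≤support c = InConv-dot≤ c (support c) (λ x → Gen-dot≤support c {x})

signedEdge∈CΠ₃ : ∀ k s → CΠ₃ (signedSum (edge k) s)
signedEdge∈CΠ₃ k s = InConv-singleton {S = Gen} (edge k , edge-isClique k , s , refl)

peakEdge : Pt 4 → Fin 3
peakEdge c = proj₁ (support-attained c)

peak : Pt 4 → Pt 4
peak c = signedSum (edge (peakEdge c)) (signs c)

dot-peak : ∀ c → dot c (peak c) ≡ support c
dot-peak c = trans (dot-signedSum-signs≡weight c (edge (peakEdge c))) (proj₂ (support-attained c))

Face⇔dot≡support : ∀ c {x} → CΠ₃ x → Face c x ⇔ (dot c x ≡ support c)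
Face⇔dot≡support c {x} x∈CΠ₃ = mk⇔ face⇒max max⇒face
  where
  face⇒max : Face c x → dot c x ≡ support c
  face⇒max (_ , maximal) = ≤-antisym (CΠ₃-dot≤support c x∈CΠ₃) (begin
    support c     ≡⟨ dot-peak c ⟨
    dot c (peak c) ≤⟨ maximal (peak c) (signedEdge∈CΠ₃ (peakEdge c) (signs c)) ⟩
    dot c x       ∎)
    where open ≤-Reasoning

  max⇒face : dot c x ≡ support c → Face c x
  max⇒face dot≡support = x∈CΠ₃ , λ y y∈CΠ₃ → subst (dot c y ≤_) (sym dot≡support) (CΠ₃-dot≤support c y∈CΠ₃)

endpointSigns : Fin 3 → Bool → Bool → Fin 4 → Bool
endpointSigns k a b i = if toℕ i ≡ᵇ toℕ k then a else b

vertex : Fin 3 × Bool × Bool → Pt 4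
vertex (k , a , b) = signedSum (edge k) (endpointSigns k a b)

vertex∈CΠ₃ : ∀ v → CΠ₃ (vertex v)
vertex∈CΠ₃ (k , a , b) = signedEdge∈CΠ₃ k (endpointSigns k a b)

vertexLabels : List (Fin 3 × Bool × Bool)
vertexLabels = cartesianProduct (allFin 3) (cartesianProduct bools bools)
  where bools = true ∷ false ∷ []

facePattern : Pt 4 → List Bool
facePattern c = map (λ v → does (dot c (vertex v) ≟ support c)) vertexLabels

fromBits : List Bool → ℕ
fromBits = foldr (λ b n → (if b then 1 else 0) ℕ.+ 2 ℕ.* n) 0

faceCode : Pt 4 → ℕ
faceCode = fromBits ∘ facePattern

SameFace⇒≡faceCode : ∀ {c c′} → SameFace c c′ → faceCode c ≡ faceCode c′
SameFace⇒≡faceCode {c} {c′} c~c′ = cong fromBits (map-cong onVertex vertexLabels)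
  where
  onVertex : ∀ v → does (dot c (vertex v) ≟ support c) ≡ does (dot c′ (vertex v) ≟ support c′)
  onVertex v = does-⇔ (⇔.trans (⇔.sym (Face⇔dot≡support c (vertex∈CΠ₃ v)))
                      (⇔.trans (mk⇔ (proj₁ (c~c′ (vertex v))) (proj₂ (c~c′ (vertex v))))
                               (Face⇔dot≡support c′ (vertex∈CΠ₃ v))))
                      (dot c (vertex v) ≟ support c) (dot c′ (vertex v) ≟ support c′)

AllPairs-lookup : ∀ {A : Set} {R : A → A → Set} {xs} → AllPairs R xs →
                  ∀ {i j} → i < j → R (lookup xs i) (lookup xs j)
AllPairs-lookup (Rx ∷ _)   {zero}  {suc j} _          = All.lookup Rx (∈-lookup j)
AllPairs-lookup (_  ∷ Rxs) {suc i} {suc j} (s<s i<j) = AllPairs-lookup Rxs i<j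

pt : ℚ → ℚ → ℚ → ℚ → Pt 4
pt a _ _ _ 0F = a
pt _ b _ _ 1F = b
pt _ _ c _ 2F = c
pt _ _ _ d 3F = d

-- One functional per non-empty face, sorted by faceCode so that distinctness is a linear check.
exposingFunctionals : List (Pt 4)
exposingFunctionals =
  pt  1  1  0  0 ∷ pt  1 -1  0  0 ∷ pt  1  0  0  0 ∷ pt -1  1  0  0 ∷
  pt -1 -1  0  0 ∷ pt -1  0  0  0 ∷ pt  0  1  1  0 ∷ pt  1  1  1  0 ∷
  pt -1  1  1  0 ∷ pt  0  1 -1  0 ∷ pt  1  1 -1  0 ∷ pt -1  1 -1  0 ∷
  pt  0  1  0  0 ∷ pt  0 -1  1  0 ∷ pt  1 -1  1  0 ∷ pt -1 -1  1  0 ∷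
  pt  0 -1 -1  0 ∷ pt  1 -1 -1  0 ∷ pt -1 -1 -1  0 ∷ pt  0 -1  0  0 ∷
  pt  0  0  1  1 ∷ pt  2  1  1  2 ∷ pt  2 -1  1  2 ∷ pt  2  0  1  1 ∷
  pt -2  1  1  2 ∷ pt -2 -1  1  2 ∷ pt -2  0  1  1 ∷ pt  0  1  1  1 ∷
  pt  1  1  1  1 ∷ pt -1  1  1  1 ∷ pt  0 -1  1  1 ∷ pt  1 -1  1  1 ∷
  pt -1 -1  1  1 ∷ pt  0  0  1 -1 ∷ pt  2  1  1 -2 ∷ pt  2 -1  1 -2 ∷
  pt  2  0  1 -1 ∷ pt -2  1  1 -2 ∷ pt -2 -1  1 -2 ∷ pt -2  0  1 -1 ∷
  pt  0  1  1 -1 ∷ pt  1  1  1 -1 ∷ pt -1  1  1 -1 ∷ pt  0 -1  1 -1 ∷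
  pt  1 -1  1 -1 ∷ pt -1 -1  1 -1 ∷ pt  0  0  1  0 ∷ pt  1  0  1  0 ∷
  pt -1  0  1  0 ∷ pt  0  0 -1  1 ∷ pt  2  1 -1  2 ∷ pt  2 -1 -1  2 ∷
  pt  2  0 -1  1 ∷ pt -2  1 -1  2 ∷ pt -2 -1 -1  2 ∷ pt -2  0 -1  1 ∷
  pt  0  1 -1  1 ∷ pt  1  1 -1  1 ∷ pt -1  1 -1  1 ∷ pt  0 -1 -1  1 ∷
  pt  1 -1 -1  1 ∷ pt -1 -1 -1  1 ∷ pt  0  0  0  1 ∷ pt  1  1  0  2 ∷
  pt  1 -1  0  2 ∷ pt  1  0  0  1 ∷ pt -1  1  0  2 ∷ pt -1 -1  0  2 ∷
  pt -1  0  0  1 ∷ pt  0  1  0  1 ∷ pt  0 -1  0  1 ∷ pt  0  0 -1 -1 ∷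
  pt  2  1 -1 -2 ∷ pt  2 -1 -1 -2 ∷ pt  2  0 -1 -1 ∷ pt -2  1 -1 -2 ∷
  pt -2 -1 -1 -2 ∷ pt -2  0 -1 -1 ∷ pt  0  1 -1 -1 ∷ pt  1  1 -1 -1 ∷
  pt -1  1 -1 -1 ∷ pt  0 -1 -1 -1 ∷ pt  1 -1 -1 -1 ∷ pt -1 -1 -1 -1 ∷
  pt  0  0  0 -1 ∷ pt  1  1  0 -2 ∷ pt  1 -1  0 -2 ∷ pt  1  0  0 -1 ∷
  pt -1  1  0 -2 ∷ pt -1 -1  0 -2 ∷ pt -1  0  0 -1 ∷ pt  0  1  0 -1 ∷
  pt  0 -1  0 -1 ∷ pt  0  0 -1  0 ∷ pt  1  0 -1  0 ∷ pt -1  0 -1  0 ∷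
  pt  0  0  0  0 ∷
  []
  where
  -- Rational literals are kept local so that ℕ literals elsewhere stay builtin.
  open import Agda.Builtin.FromNat using (Number; fromNat)
  open import Agda.Builtin.FromNeg using (Negative; fromNeg)
  import Data.Rational.Literals as Literals
  open import Data.Unit using (⊤; tt)

  instance
    _ : ⊤
    _ = tt

    _ : Number ℚ
    _ = Literals.number

    _ : Negative ℚ
    _ = Literals.negative

exposingFunctionals-distinctFaces : AllPairs (λ c c′ → faceCode c ℕ.< faceCode c′) exposingFunctionals
exposingFunctionals-distinctFaces = Linked⇒AllPairs ℕₚ.<-trans
  (Linked.map⁻ (from-yes (linked? ℕ._<?_ (map faceCode exposingFunctionals))))

lemma4p12 : ¬ HasExactlyFaces 81
lemma4p12 (c , _ , covered) = collide (pigeonhole (from-yes (81 ℕ.<? 97)) face)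
  where
  face : Fin 97 → Fin 81
  face = proj₁ ∘ covered ∘ lookup exposingFunctionals

  faceCode≡ : ∀ k → faceCode (lookup exposingFunctionals k) ≡ faceCode (c (face k))
  faceCode≡ k = SameFace⇒≡faceCode {lookup exposingFunctionals k} {c (face k)} (proj₂ (covered _))

  collide : (∃₂ λ i j → i < j × face i ≡ face j) → ⊥
  collide (i , j , i<j , same) = ℕₚ.<-irrefl
    (trans (faceCode≡ i) (trans (cong (faceCode ∘ c) same) (sym (faceCode≡ j))))
    (AllPairs-lookup exposingFunctionals-distinctFaces i<j)
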